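{- Let $\kappa\le\lambda$ be infinite cardinals and let $\langle X,r,A\rangle$ be a Chu space. (1) If $\langle X,r,A\rangle$ is $\langle\kappa,\lambda\rangle$-compact, then it is $\langle\kappa,\lambda\rangle$-absolutely closed. (2) If $\langle X,r,A\rangle$ is $\langle\kappa,\lambda\rangle$-absolutely closed and admits complements and ${<}\kappa$-intersections, then it is $\langle\kappa,\lambda\rangle$-compact.
   Context: A Chu space is a triple $\langle X,r,A\rangle$ with $r\subseteq X\times A$. It admits complements if for every $a\in A$ there is $b\in A$ with $\langle x,a\rangle\in r\iff\langle x,b\rangle\notin r$ for all $x\in X$. It admits ${<}\kappa$-intersections if for every $B\subseteq A$ with $|B|<\kappa$ there is $c\in A$ such that for all $x\in X$, $\langle x,c\rangle\in r\iff\forall b\in B\,(\langle x,b\rangle\in r)$. It is $\langle\kappa,\lambda\rangle$-compact if for every sequence $\langle a_\alpha:\alpha<\lambda\rangle$ of elements of $A$, either there is $x\in X$ with $\langle x,a_\alpha\rangle\notin r$ for all $\alpha<\lambda$, or there is $Z\subseteq\lambda$ with $|Z|<\kappa$ such that every $x\in X$ satisfies $\langle x,a_\alpha\rangle\in r$ for some $\alpha\in Z$. It is $\langle\kappa,\lambda\rangle$-absolutely closed if for every sequence $\langle a_\alpha:\alpha<\lambda\rangle$ of elements of $A$, either there is $x\in X$ with $\langle x,a_\alpha\rangle\notin r$ for all $\alpha<\lambda$, or there is $Z\subseteq\lambda$ with $|Z|<\kappa$ such that for every $a\in A$, either there is no $x\in X$ with $\langle x,a\rangle\in r$, or there is $x\in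 X$ with $\langle x,a\rangle\in r$ and $\langle x,a_\alpha\rangle\in r$ for some $\alpha\in Z$. -}

module Defs where

open import Data.Bool using (Bool; true)
open import Data.Nat using (ℕ)
open import Data.Product using (Σ; ∃; _×_; _,_)
open import Data.Sum using (_⊎_)
open import Function.Bundles using (_↣_; _⇔_)
open import Relation.Binary.PropositionalEquality using (_≡_)
open import Relation.Nullary using (¬_)

-- Cardinals are represented by (carrier) types; cardinal comparison via injections.
_≤ᶜ_ : Set → Set → Set
S ≤ᶜ T = S ↣ T

-- |S| < |T| : S injects into T but T does not inject into S
-- (equivalent, classically via Cantor–Schröder–Bernstein, to "injection and no bijection").
_<ᶜ_ : Set → Set → Set
S <ᶜ T = (S ↣ T) × ¬ (T ↣ S)

Infinite : Set → Set
Infinite K = ℕ ↣ K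

Subset : Set → Set
Subset T = T → Bool

_∈ₛ_ : {T : Set} → T → Subset T → Set
t ∈ₛ Z = Z t ≡ true

-- The type of elements of a subset (its cardinality is the cardinality of the subset).
⟦_⟧ : {T : Set} → Subset T → Set
⟦_⟧ {T} Z = Σ T (λ t → t ∈ₛ Z)

record Chu : Set₁ where
  field
    X : Set
    A : Set
    r : X → A → Set

module _ (C : Chu) where
  open Chu C

  AdmitsComplements : Set
  AdmitsComplements = ∀ (a : A) → ∃ λ (b : A) → ∀ (x : X) → (r x a ⇔ (¬ r x b))

  AdmitsIntersections : (K : Set) → Set
  AdmitsIntersections K =
    ∀ (B : Subset A) → ⟦ B ⟧ <ᶜ K →
      ∃ λ (c : A) → ∀ (x : X) → (r x c ⇔ (∀ (b : A) → b ∈ₛ B → r x b))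

  -- ⟨κ,λ⟩-compact, κ represented by K and λ by L (sequences are maps L → A)
  Compact : (K L : Set) → Set
  Compact K L =
    ∀ (a : L → A) →
      (∃ λ (x : X) → ∀ (α : L) → ¬ r x (a α))
      ⊎ (∃ λ (Z : Subset L) → (⟦ Z ⟧ <ᶜ K) ×
           (∀ (x : X) → ∃ λ (α : L) → α ∈ₛ Z × r x (a α)))

  AbsolutelyClosed : (K L : Set) → Set
  AbsolutelyClosed K L =
    ∀ (a : L → A) →
      (∃ λ (x : X) → ∀ (α : L) → ¬ r x (a α))
      ⊎ (∃ λ (Z : Subset L) → (⟦ Z ⟧ <ᶜ K) ×
           (∀ (b : A) →
              (¬ (∃ λ (x : X) → r x b))
              ⊎ (∃ λ (x : X) → r x b × (∃ λ (α : L) → α ∈ₛ Z × r x (a α)))))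

{-# OPTIONS --safe #-}
module Submission where

-- A subcover is in particular absolutely closing: a point of an inhabited b lies in some a α.
-- Conversely, if ⟨a α : α ∈ Z⟩ does not cover X, the intersection c of the complements of the
-- a α (α ∈ Z) is inhabited; the family of these complements is an image of Z, hence of size
-- < κ, so c is an element of A. Being disjoint from every a α with α ∈ Z, c contradicts
-- absolute closedness.

open import Defs
open import Level using (0ℓ)
open import Axiom.ExcludedMiddle using (ExcludedMiddle)
open import Axiom.DoubleNegationElimination using (em⇒dne)
open import Axiom.UniquenessOfIdentityProofs using (module Decidable⇒UIP)
open import Data.Bool using (_≟_)
open import Data.Bool.Properties using (T-≡)
open import Data.Empty using (⊥-elim)
open import Data.Product using (_×_; _,_; proj₁; proj₂; ∃)
open import Data.Product.Properties using (Σ-≡,≡→≡)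
open import Data.Sum using (_⊎_; inj₁; inj₂)
open import Function using (_∘_)
open import Function.Bundles using (_⇔_; mk⇔; mk↣; Equivalence)
open import Function.Construct.Composition using (_↣-∘_)
open import Relation.Binary.PropositionalEquality using (_≡_; refl; sym; trans; cong)
open import Relation.Nullary using (¬_; yes; no)
open import Relation.Nullary.Decidable using (⌊_⌋; toWitness; fromWitness)

open Equivalence using (to; from)

≤ᶜ-<ᶜ-trans : {S T K : Set} → S ≤ᶜ T → T <ᶜ K → S <ᶜ K
≤ᶜ-<ᶜ-trans S↣T (T↣K , K↣̸T) = T↣K ↣-∘ S↣T , λ K↣S → K↣̸T (S↣T ↣-∘ K↣S)

⟦⟧-≡ : {T : Set} {Z : Subset T} {u v : ⟦ Z ⟧} → proj₁ u ≡ proj₁ v → u ≡ v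
⟦⟧-≡ eq = Σ-≡,≡→≡ (eq , Decidable⇒UIP.≡-irrelevant _≟_ _ _)

module _ (lem : ExcludedMiddle 0ℓ) where

  image : {S T : Set} → (S → T) → Subset S → Subset T
  image f Z t = ⌊ lem {∃ λ s → s ∈ₛ Z × f s ≡ t} ⌋

  module _ {S T : Set} {f : S → T} {Z : Subset S} where

    ∈-image⁻ : ∀ {t} → t ∈ₛ image f Z → ∃ λ s → s ∈ₛ Z × f s ≡ t
    ∈-image⁻ = toWitness ∘ from T-≡

    ∈-image⁺ : ∀ {s} → s ∈ₛ Z → f s ∈ₛ image f Z
    ∈-image⁺ s∈Z = to T-≡ (fromWitness (_ , s∈Z , refl))

    image-≤ᶜ : ⟦ image f Z ⟧ ≤ᶜ ⟦ Z ⟧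
    image-≤ᶜ = mk↣ {to = preimage} preimage-injective
      where
      preimage : ⟦ image f Z ⟧ → ⟦ Z ⟧
      preimage (_ , t∈fZ) = proj₁ (∈-image⁻ t∈fZ) , proj₁ (proj₂ (∈-image⁻ t∈fZ))

      f∘preimage : ∀ u → f (proj₁ (preimage u)) ≡ proj₁ u
      f∘preimage (_ , t∈fZ) = proj₂ (proj₂ (∈-image⁻ t∈fZ))

      preimage-injective : ∀ {u v} → preimage u ≡ preimage v → u ≡ v
      preimage-injective {u} {v} eq =
        ⟦⟧-≡ (trans (sym (f∘preimage u)) (trans (cong (f ∘ proj₁) eq) (f∘preimage v)))

  module _ (C : Chu) where
    open Chu C

    Inhabited : A → Set
    Inhabited b = ∃ λ x → r x b

    Covers : {L : Set} → (L → A) → Subset L → Set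
    Covers a Z = ∀ x → ∃ λ α → α ∈ₛ Z × r x (a α)

    CoversAbsolutely : {L : Set} → (L → A) → Subset L → Set
    CoversAbsolutely a Z =
      ∀ b → ¬ Inhabited b ⊎ ∃ λ x → r x b × ∃ λ α → α ∈ₛ Z × r x (a α)

    covers⇒coversAbsolutely : {L : Set} {a : L → A} {Z : Subset L} →
                              Covers a Z → CoversAbsolutely a Z
    covers⇒coversAbsolutely cover b with lem {Inhabited b}
    ... | yes (x , x∈b) = inj₂ (x , x∈b , cover x)
    ... | no  b-empty   = inj₁ b-empty

    module _ (complements : AdmitsComplements C) where

      ∁ : A → A
      ∁ a = proj₁ (complements a)

      ∈∁⇔∉ : ∀ x a → r x (∁ a) ⇔ (¬ r x a)
      ∈∁⇔∉ x a = mk⇔ (λ x∈∁a x∈a → to (spec x) x∈a x∈∁a)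
                     (λ x∉a → em⇒dne lem λ x∉∁a → x∉a (from (spec x) x∉∁a))
        where
        spec : ∀ x → r x a ⇔ (¬ r x (∁ a))
        spec = proj₂ (complements a)

      intersectionOfComplements :
        {K L : Set} → AdmitsIntersections C K → (a : L → A) (Z : Subset L) → ⟦ Z ⟧ <ᶜ K →
        ∃ λ c → ∀ x → r x c ⇔ (∀ α → α ∈ₛ Z → ¬ r x (a α))
      intersectionOfComplements intersections a Z Z<K =
        c , λ x → mk⇔ (avoids x) (λ x∉a → from (c-spec x) (in-∁ x x∉a))
        where
        ∁a[Z] : Subset A
        ∁a[Z] = image (∁ ∘ a) Z

        c : A
        c = proj₁ (intersections ∁a[Z] (≤ᶜ-<ᶜ-trans image-≤ᶜ Z<K))

        c-spec : ∀ x → r x c ⇔ (∀ b → b ∈ₛ ∁a[Z] → r x b)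
        c-spec = proj₂ (intersections ∁a[Z] (≤ᶜ-<ᶜ-trans image-≤ᶜ Z<K))

        avoids : ∀ x → r x c → ∀ α → α ∈ₛ Z → ¬ r x (a α)
        avoids x x∈c α α∈Z = to (∈∁⇔∉ x (a α)) (to (c-spec x) x∈c (∁ (a α)) (∈-image⁺ α∈Z))

        in-∁ : ∀ x → (∀ α → α ∈ₛ Z → ¬ r x (a α)) → ∀ b → b ∈ₛ ∁a[Z] → r x b
        in-∁ x x∉a b b∈∁a[Z] with ∈-image⁻ b∈∁a[Z]
        ... | α , α∈Z , refl = from (∈∁⇔∉ x (a α)) (x∉a α α∈Z)

      coversAbsolutely⇒covers :
        {K L : Set} {a : L → A} {Z : Subset L} → AdmitsIntersections C K → ⟦ Z ⟧ <ᶜ K →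
        CoversAbsolutely a Z → Covers a Z
      coversAbsolutely⇒covers {a = a} {Z} intersections Z<K absolute x =
        em⇒dne lem λ uncovered →
          c-empty (x , from (c-spec x) λ α α∈Z x∈aα → uncovered (α , α∈Z , x∈aα))
        where
        c : A
        c = proj₁ (intersectionOfComplements intersections a Z Z<K)

        c-spec : ∀ x → r x c ⇔ (∀ α → α ∈ₛ Z → ¬ r x (a α))
        c-spec = proj₂ (intersectionOfComplements intersections a Z Z<K)

        c-empty : ¬ Inhabited c
        c-empty with absolute c
        ... | inj₁ empty = empty
        ... | inj₂ (y , y∈c , α , α∈Z , y∈aα) = ⊥-elim (to (c-spec y) y∈c α α∈Z y∈aα)

proposition4p10 : ExcludedMiddle 0ℓ →
    (K L : Set) → Infinite K → Infinite L → K ≤ᶜ L →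
    (C : Chu) →
      (Compact C K L → AbsolutelyClosed C K L)
      × (AbsolutelyClosed C K L → AdmitsComplements C → AdmitsIntersections C K →
           Compact C K L)
proposition4p10 lem K L _ _ _ C = compact⇒absolutelyClosed , absolutelyClosed⇒compact
  where
  compact⇒absolutelyClosed : Compact C K L → AbsolutelyClosed C K L
  compact⇒absolutelyClosed compact a with compact a
  ... | inj₁ avoided            = inj₁ avoided
  ... | inj₂ (Z , Z<K , cover) = inj₂ (Z , Z<K , covers⇒coversAbsolutely lem C cover)

  absolutelyClosed⇒compact : AbsolutelyClosed C K L → AdmitsComplements C →
                             AdmitsIntersections C K → Compact C K L
  absolutelyClosed⇒compact closed complements intersections a with closed a
  ... | inj₁ avoided               = inj₁ avoided
  ... | inj₂ (Z , Z<K , absolute) =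
    inj₂ (Z , Z<K , coversAbsolutely⇒covers lem C complements intersections Z<K absolute)
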